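{- Let $P$ be a finite poset, $P^*\subseteq P$ a subset containing all minimal and all maximal elements of $P$, and $\lambda:P^*\to\mathbb R$ order-preserving. For $\lambda$-admissible chains $L,L'$ of order ideals of $P$, the polytope $F_L$ is a face of $F_{L'}$ if and only if $L\subseteq L'$ (i.e. $L$ is obtained from $L'$ by deleting some of its ideals).
   Context: An order ideal of $P$ is a subset $I$ such that $x\in I$, $y\preceq x$ imply $y\in I$. A chain of order ideals is a sequence $L=(\emptyset=I_0\subsetneq I_1\subsetneq\cdots\subsetneq I_m\subsetneq I_{m+1}=P)$ of order ideals. It is $\lambda$-admissible if for every $i$ the set $\lambda((I_i\setminus I_{i-1})\cap P^*)$ is either empty or a singleton $\{t_i\}$, and $t_i<t_j$ whenever $i<j$ and both are defined. $F_L\subseteq\mathbb R^P$ is the set of $x:P\to\mathbb R$ with $x|_{P^*}=\lambda$, $x$ constant on each $I_i\setminus I_{i-1}$ ($1\le i\le m+1$), and $x(I_1)\le x(I_2\setminus I_1)\le\cdots\le x(I_{m+1}\setminus I_m)$. -}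

module Defs where

open import Level using (Level; 0ℓ) renaming (suc to lsuc)
open import Data.Nat using (ℕ; zero; suc)
open import Data.Fin as Fin using (Fin; inject₁)
open import Data.Fin.Subset as Sub using (Subset; _∈_; _∉_; _⊂_)
open import Data.Vec as Vec using (Vec; _∷_; _∷ʳ_; lookup)
import Data.Vec.Membership.Propositional as VecMem
open import Data.Product using (Σ; _×_; ∃; _,_)
open import Relation.Binary using (Rel; IsTotalOrder; IsPartialOrder; Decidable)
open import Relation.Binary.PropositionalEquality using (_≡_; _≢_)
open import Relation.Nullary using (¬_)
open import Algebra.Structures using (IsCommutativeRing)
open import Function.Bundles using (_⇔_)

-- The real numbers, axiomatised as a complete ordered field
-- (with propositional equality and, as in classical mathematics,
-- a decidable order).  Any model is (classically) isomorphic to ℝ.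

record Reals : Set₁ where
  infixl 6 _+_
  infixl 7 _*_
  infix 4 _≤_ _<_
  field
    Carrier : Set
    _+_ _*_ : Carrier → Carrier → Carrier
    -_      : Carrier → Carrier
    0# 1#   : Carrier
    _≤_     : Carrier → Carrier → Set
    isCommutativeRing : IsCommutativeRing _≡_ _+_ _*_ -_ 0# 1#
    0≢1     : 0# ≢ 1#
    inverse : ∀ x → x ≢ 0# → ∃ λ y → x * y ≡ 1#
    isTotalOrder : IsTotalOrder _≡_ _≤_
    _≤?_    : Decidable _≤_
    +-mono-≤ : ∀ {x y} z → x ≤ y → x + z ≤ y + z
    *-nonneg : ∀ {x y} → 0# ≤ x → 0# ≤ y → 0# ≤ x * y
    lub : (S : Carrier → Set) → (∃ λ s → S s) → (∃ λ b → ∀ s → S s → s ≤ b) →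
          ∃ λ u → (∀ s → S s → s ≤ u) × (∀ b → (∀ s → S s → s ≤ b) → u ≤ b)

  _<_ : Carrier → Carrier → Set
  x < y = x ≤ y × x ≢ y

module Geometry (ℝ : Reals) where
  open Reals ℝ

  dot : ∀ {k} → (Fin k → Carrier) → (Fin k → Carrier) → Carrier
  dot {zero}  c x = 0#
  dot {suc k} c x = c Fin.zero * x Fin.zero + dot (λ i → c (Fin.suc i)) (λ i → x (Fin.suc i))

  -- F is a face of Q: F = Q ∩ {x | c·x = c₀} for some linear functional c and
  -- c₀ ∈ ℝ with c·x ≤ c₀ for all x ∈ Q (standard definition, includes ∅ and Q).
  IsFace : ∀ {k} → ((Fin k → Carrier) → Set) → ((Fin k → Carrier) → Set) → Set
  IsFace {k} F Q = Σ (Fin k → Carrier) λ c → Σ Carrier λ c₀ →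
      (∀ x → Q x → dot c x ≤ c₀) ×
      (∀ x → F x ⇔ (Q x × dot c x ≡ c₀))

module Setup (ℝ : Reals) {n : ℕ} (_≼_ : Rel (Fin n) 0ℓ)
             (Pstar : Subset n) (lam : Fin n → Reals.Carrier ℝ) where
  open Reals ℝ
  open Geometry ℝ public

  IsMinimal IsMaximal : Fin n → Set
  IsMinimal x = ∀ y → y ≼ x → y ≡ x
  IsMaximal x = ∀ y → x ≼ y → y ≡ x

  ContainsExtremes : Set
  ContainsExtremes = ∀ x → (IsMinimal x → x ∈ Pstar) × (IsMaximal x → x ∈ Pstar)

  -- λ : P* → ℝ order-preserving (only the values of lam on P* matter)
  OrderPreserving : Set
  OrderPreserving = ∀ x y → x ∈ Pstar → y ∈ Pstar → x ≼ y → lam x ≤ lam y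

  IsOrderIdeal : Subset n → Set
  IsOrderIdeal I = ∀ x y → x ∈ I → y ≼ x → y ∈ I

  -- A chain  ∅ = I₀ ⊊ I₁ ⊊ ⋯ ⊊ I_m ⊊ I_{m+1} = P  is given by the vector
  -- L = (I₁ , … , I_m) of its inner ideals.
  ideal : ∀ {m} → Vec (Subset n) m → Fin (suc (suc m)) → Subset n
  ideal L k = lookup (Sub.⊥ ∷ (L ∷ʳ Sub.⊤)) k

  IsChain : ∀ {m} → Vec (Subset n) m → Set
  IsChain {m} L = (∀ k → IsOrderIdeal (ideal L k)) ×
                  (∀ (i : Fin (suc m)) → ideal L (inject₁ i) ⊂ ideal L (Fin.suc i))

  -- p lies in the i-th block  I_i ∖ I_{i-1}  (blocks indexed 1..m+1 as Fin (suc m))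
  InBlock : ∀ {m} → Vec (Subset n) m → Fin (suc m) → Fin n → Set
  InBlock L i p = p ∈ ideal L (Fin.suc i) × p ∉ ideal L (inject₁ i)

  IsAdmissible : ∀ {m} → Vec (Subset n) m → Set
  IsAdmissible {m} L = IsChain L ×
    (∀ i p q → InBlock L i p → p ∈ Pstar → InBlock L i q → q ∈ Pstar → lam p ≡ lam q) ×
    (∀ i j → i Fin.< j → ∀ p q → InBlock L i p → p ∈ Pstar →
                                 InBlock L j q → q ∈ Pstar → lam p < lam q)

  F : ∀ {m} → Vec (Subset n) m → (Fin n → Carrier) → Set
  F {m} L x =
    (∀ p → p ∈ Pstar → x p ≡ lam p) ×
    (∀ i p q → InBlock L i p → InBlock L i q → x p ≡ x q) ×
    (∀ (i : Fin m) p q → InBlock L (inject₁ i) p → InBlock L (Fin.suc i) q → x p ≤ x q)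

  SubChain : ∀ {m m'} → Vec (Subset n) m → Vec (Subset n) m' → Set
  SubChain L L' = ∀ I → I VecMem.∈ L → I VecMem.∈ L'

{-# OPTIONS --safe #-}
-- Number the blocks I_{i+1} ∖ I_i of a chain L by block L : P → Fin (m+1). For an admissible
-- chain, F_L is exactly the set of x that agree with λ on P* and are monotone along block L.
-- If L ⊆ L', every block of L is a union of consecutive blocks of L', so F_L ⊆ F_L', and F_L is
-- cut out of F_L' by the valid inequality Σ (x_p − x_q) ≤ 0, summed over the pairs p, q lying in
-- one block of L but in increasing blocks of L'.
-- Conversely, a face is in particular a subset. For every i, F_L contains a point that jumps
-- strictly between block i and block i+1 of L; as it lies in F_L', it is monotone along block L',
-- so the block order of L' refines that of L. Each ideal of L is then a union of initial blocks
-- of L', i.e. an ideal of L'.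

module Submission where

open import Defs
open import Level using (0ℓ)
open import Data.Nat as ℕ using (ℕ; zero; suc; z≤n; s≤s)
import Data.Nat.Properties as ℕ
open import Data.Fin as Fin using (Fin; zero; suc; inject₁; toℕ)
import Data.Fin.Properties as Fin
open import Data.Fin.Relation.Unary.Top using (view; ‵fromℕ; ‵inject₁)
open import Data.Fin.Subset using (Subset; _∈_; _∉_; _⊆_; ⊤)
open import Data.Fin.Subset.Properties using (∈⊤; ∉⊥; _∈?_; ⊆-antisym)
open import Data.Vec using (Vec; []; _∷_; _∷ʳ_; lookup)
open import Data.Vec.Membership.Propositional using () renaming (_∈_ to _∈ᵛ_)
open import Data.Vec.Membership.Propositional.Properties using (∈-lookup)
open import Data.Vec.Relation.Unary.Any using (index)
open import Data.Vec.Relation.Unary.Any.Properties using (lookup-index)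
open import Data.List using (List; map; filter; allFin)
open import Data.List.Membership.Propositional using () renaming (_∈_ to _∈ˡ_)
open import Data.List.Membership.Propositional.Properties using (∈-map⁺; ∈-map⁻; ∈-filter⁺; ∈-filter⁻; ∈-allFin)
import Data.List.Relation.Unary.All as All
open import Data.List.Relation.Unary.All.Properties using (all-filter)
open import Data.Product using (∃; _×_; _,_; proj₁; proj₂)
open import Data.Sum using (inj₁; inj₂)
open import Data.Empty using (⊥-elim)
open import Relation.Binary using (Rel; IsPartialOrder)
open import Relation.Binary.Bundles using (Preorder; TotalOrder)
open import Relation.Binary.PropositionalEquality using (_≡_; refl; sym; trans; cong; cong₂; subst; subst₂; module ≡-Reasoning)
open import Relation.Nullary using (Dec; yes; no; contradiction)
open import Relation.Nullary.Decidable using (_×-dec_)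
open import Relation.Unary using (Pred)
import Relation.Unary
open import Relation.Unary.Properties using (U?)
open import Function using (_∘_; case_of_)
open import Function.Bundles using (_⇔_; mk⇔; Equivalence)
open import Algebra.Bundles using (CommutativeRing)

lookup-∷ʳ-inject₁ : ∀ {a} {A : Set a} {m} (xs : Vec A m) x (j : Fin m) → lookup (xs ∷ʳ x) (inject₁ j) ≡ lookup xs j
lookup-∷ʳ-inject₁ (y ∷ xs) x zero    = refl
lookup-∷ʳ-inject₁ (y ∷ xs) x (suc j) = lookup-∷ʳ-inject₁ xs x j

module _ {a ℓ₁ ℓ₂} (P : Preorder a ℓ₁ ℓ₂) where
  open Preorder P using (Carrier; _≲_) renaming (refl to ≲-refl; trans to ≲-trans)

  stepwise⇒monotone : ∀ {m} (t : Fin (suc m) → Carrier) → (∀ (j : Fin m) → t (inject₁ j) ≲ t (suc j)) →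
                      ∀ {i j} → i Fin.≤ j → t i ≲ t j
  stepwise⇒monotone         t step {zero}  {zero}  _          = ≲-refl
  stepwise⇒monotone {suc m} t step {zero}  {suc j} _          =
    ≲-trans (step zero) (stepwise⇒monotone (t ∘ suc) (step ∘ suc) {zero} {j} z≤n)
  stepwise⇒monotone {suc m} t step {suc i} {suc j} (s≤s i≤j) = stepwise⇒monotone (t ∘ suc) (step ∘ suc) i≤j

module _ {n : ℕ} where

  -- ideal⁺ L i is the ideal I_{i+1} of the chain L (ideal L (suc i) in Setup), and block L p is
  -- the least i with p ∈ ideal⁺ L i.
  ideal⁺ : ∀ {m} → Vec (Subset n) m → Fin (suc m) → Subset n
  ideal⁺ L = lookup (L ∷ʳ ⊤)

  Ascending : ∀ {m} → Vec (Subset n) m → Set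
  Ascending {m} L = ∀ (j : Fin m) → ideal⁺ L (inject₁ j) ⊆ ideal⁺ L (suc j)

  block : ∀ {m} → Vec (Subset n) m → Fin n → Fin (suc m)
  block []      p = zero
  block (I ∷ L) p with p ∈? I
  ... | yes _ = zero
  ... | no  _ = suc (block L p)

  ∈-ideal⁺-block : ∀ {m} (L : Vec (Subset n) m) p → p ∈ ideal⁺ L (block L p)
  ∈-ideal⁺-block []      p = ∈⊤
  ∈-ideal⁺-block (I ∷ L) p with p ∈? I
  ... | yes p∈I = p∈I
  ... | no  _   = ∈-ideal⁺-block L p

  block-minimal : ∀ {m} (L : Vec (Subset n) m) {p i} → p ∈ ideal⁺ L i → block L p Fin.≤ i
  block-minimal []      _ = z≤n
  block-minimal (I ∷ L) {p} {i} p∈ with p ∈? I | i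
  ... | yes _   | _     = z≤n
  ... | no  p∉I | zero  = contradiction p∈ p∉I
  ... | no  _   | suc i = s≤s (block-minimal L p∈)

  block≤⇒∈ideal⁺ : ∀ {m} (L : Vec (Subset n) m) → Ascending L → ∀ {p i} → block L p Fin.≤ i → p ∈ ideal⁺ L i
  block≤⇒∈ideal⁺ []      _ {i = zero} _ = ∈⊤
  block≤⇒∈ideal⁺ (I ∷ L) asc {p} {i} b≤i with p ∈? I | i
  ... | yes p∈I | zero  = p∈I
  ... | yes p∈I | suc i = block≤⇒∈ideal⁺ L (λ j → asc (suc j))
                            (ℕ.≤-trans (block-minimal L (asc zero p∈I)) z≤n)
  ... | no  _   | suc i = block≤⇒∈ideal⁺ L (λ j → asc (suc j)) (ℕ.s≤s⁻¹ b≤i)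

  ideal⁺-of-downClosed : ∀ {m} (L : Vec (Subset n) m) → Ascending L → (D : Subset n) {w : Fin n} → w ∈ D →
                         (∀ {q r} → q ∈ D → block L r Fin.≤ block L q → r ∈ D) → ∃ λ i → D ≡ ideal⁺ L i
  ideal⁺-of-downClosed {m} L asc D {w} w∈D closed = block L top , ⊆-antisym D⊆ ⊆D
    where
    open import Data.List.Extrema (Fin.≤-totalOrder (suc m)) using (argmax; argmax-all; f[xs]≤f[argmax])
    members : List (Fin n)
    members = filter (_∈? D) (allFin n)
    top : Fin n
    top = argmax (block L) w members
    ≤top : ∀ {r} → r ∈ D → block L r Fin.≤ block L top
    ≤top r∈D = All.lookup (f[xs]≤f[argmax] w members) (∈-filter⁺ (_∈? D) (∈-allFin _) r∈D)
    D⊆ : D ⊆ ideal⁺ L (block L top)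
    D⊆ r∈D = block≤⇒∈ideal⁺ L asc (≤top r∈D)
    ⊆D : ideal⁺ L (block L top) ⊆ D
    ⊆D r∈ = closed (argmax-all (block L) w∈D (all-filter (_∈? D) (allFin n))) (block-minimal L r∈)

  ideal⁺-inject₁-∈ : ∀ {m} (L : Vec (Subset n) m) (j : Fin m) → ideal⁺ L (inject₁ j) ∈ᵛ L
  ideal⁺-inject₁-∈ L j = subst (_∈ᵛ L) (sym (lookup-∷ʳ-inject₁ L ⊤ j)) (∈-lookup j L)

  ∈⇒ideal⁺-inject₁ : ∀ {m} {L : Vec (Subset n) m} {I} → I ∈ᵛ L → ∃ λ j → I ≡ ideal⁺ L (inject₁ j)
  ∈⇒ideal⁺-inject₁ {L = L} I∈L = index I∈L , trans (lookup-index I∈L) (sym (lookup-∷ʳ-inject₁ L ⊤ (index I∈L)))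

  CoarserThan : ∀ {m m'} → Vec (Subset n) m → Vec (Subset n) m' → Set
  CoarserThan L L' = ∀ {p q} → block L' p Fin.≤ block L' q → block L p Fin.≤ block L q

module RealsProperties (ℝ : Reals) where
  open Reals ℝ

  totalOrder : TotalOrder 0ℓ 0ℓ 0ℓ
  totalOrder = record { isTotalOrder = isTotalOrder }

  commutativeRing : CommutativeRing 0ℓ 0ℓ
  commutativeRing = record { isCommutativeRing = isCommutativeRing }

  open TotalOrder totalOrder public
    using (preorder; poset; antisym; total) renaming (refl to ≤-refl; reflexive to ≤-reflexive)
  open CommutativeRing commutativeRing
    using (ring; +-commutativeMonoid; +-comm; +-assoc; +-identityˡ; +-identityʳ; -‿inverseˡ; -‿inverseʳ)
  open import Algebra.Properties.Ring ring using (-1*x≈-x; -‿involutive; +-identityʳ-unique; x∙y⁻¹≈ε⇒x≈y)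
  open import Algebra.Properties.CommutativeMonoid.Sum +-commutativeMonoid public using (sum; sum-cong-≗)
  open import Algebra.Properties.CommutativeMonoid.Sum +-commutativeMonoid using (sum-replicate-zero)
  open import Relation.Binary.Properties.Poset poset public using (<⇒≱)
  open import Relation.Binary.Construct.NonStrictToStrict _≡_ _≤_ public using (<⇒≤)
  open import Relation.Binary.Reasoning.PartialOrder poset

  +-monoˡ-≤ : ∀ x {y z} → y ≤ z → x + y ≤ x + z
  +-monoˡ-≤ x {y} {z} y≤z = subst₂ _≤_ (+-comm y x) (+-comm z x) (+-mono-≤ x y≤z)

  0≤1 : 0# ≤ 1#
  0≤1 with total 0# 1#
  ... | inj₁ 0≤1 = 0≤1
  ... | inj₂ 1≤0 = ⊥-elim (0≢1 (antisym 0≤[-1]*[-1] 1≤0))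
    where
    0≤-1 : 0# ≤ - 1#
    0≤-1 = begin
      0#           ≡⟨ sym (-‿inverseʳ 1#) ⟩
      1# + - 1#    ≤⟨ +-mono-≤ (- 1#) 1≤0 ⟩
      0# + - 1#    ≡⟨ +-identityˡ (- 1#) ⟩
      - 1#         ∎
    0≤[-1]*[-1] : 0# ≤ 1#
    0≤[-1]*[-1] = begin
      0#           ≤⟨ *-nonneg 0≤-1 0≤-1 ⟩
      - 1# * - 1#  ≡⟨ -1*x≈-x (- 1#) ⟩
      - - 1#       ≡⟨ -‿involutive 1# ⟩
      1#           ∎

  x<x+1 : ∀ x → x < x + 1#
  x<x+1 x = (begin x ≡⟨ sym (+-identityʳ x) ⟩ x + 0# ≤⟨ +-monoˡ-≤ x 0≤1 ⟩ x + 1# ∎)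
          , λ x≡x+1 → 0≢1 (sym (+-identityʳ-unique x 1# (sym x≡x+1)))

  x-1<x : ∀ x → x + - 1# < x
  x-1<x x = subst (x + - 1# <_) x-1+1≡x (x<x+1 (x + - 1#))
    where
    x-1+1≡x : x + - 1# + 1# ≡ x
    x-1+1≡x = trans (+-assoc x (- 1#) 1#) (trans (cong (x +_) (-‿inverseˡ 1#)) (+-identityʳ x))

  x≤y⇒x-y≤0 : ∀ {x y} → x ≤ y → x + - y ≤ 0#
  x≤y⇒x-y≤0 {x} {y} x≤y = begin x + - y ≤⟨ +-mono-≤ (- y) x≤y ⟩ y + - y ≡⟨ -‿inverseʳ y ⟩ 0# ∎

  x-y≡0⇒x≡y : ∀ {x y} → x + - y ≡ 0# → x ≡ y
  x-y≡0⇒x≡y {x} {y} = x∙y⁻¹≈ε⇒x≈y x y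

  x≡y⇒x-y≡0 : ∀ {x y} → x ≡ y → x + - y ≡ 0#
  x≡y⇒x-y≡0 {x} refl = -‿inverseʳ x

  +-nonpos : ∀ {x y} → x ≤ 0# → y ≤ 0# → x + y ≤ 0#
  +-nonpos {x} {y} x≤0 y≤0 = begin x + y ≤⟨ +-monoˡ-≤ x y≤0 ⟩ x + 0# ≡⟨ +-identityʳ x ⟩ x ≤⟨ x≤0 ⟩ 0# ∎

  +-nonpos-zero : ∀ {x y} → x ≤ 0# → y ≤ 0# → x + y ≡ 0# → x ≡ 0# × y ≡ 0#
  +-nonpos-zero {x} {y} x≤0 y≤0 x+y≡0 =
      antisym x≤0 (begin 0# ≡⟨ sym x+y≡0 ⟩ x + y ≤⟨ +-monoˡ-≤ x y≤0 ⟩ x + 0# ≡⟨ +-identityʳ x ⟩ x ∎)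
    , antisym y≤0 (begin 0# ≡⟨ sym x+y≡0 ⟩ x + y ≤⟨ +-mono-≤ y x≤0 ⟩ 0# + y ≡⟨ +-identityˡ y ⟩ y ∎)

  sum-nonpos : ∀ {k} (f : Fin k → Carrier) → (∀ i → f i ≤ 0#) → sum f ≤ 0#
  sum-nonpos {zero}  f f≤0 = ≤-refl
  sum-nonpos {suc k} f f≤0 = +-nonpos (f≤0 zero) (sum-nonpos (f ∘ suc) (f≤0 ∘ suc))

  sum-nonpos-zero : ∀ {k} (f : Fin k → Carrier) → (∀ i → f i ≤ 0#) → sum f ≡ 0# → ∀ i → f i ≡ 0#
  sum-nonpos-zero {suc k} f f≤0 Σf≡0 i with +-nonpos-zero (f≤0 zero) (sum-nonpos (f ∘ suc) (f≤0 ∘ suc)) Σf≡0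
  sum-nonpos-zero {suc k} f f≤0 Σf≡0 zero    | f0≡0 , _    = f0≡0
  sum-nonpos-zero {suc k} f f≤0 Σf≡0 (suc i) | _    , Σ≡0 = sum-nonpos-zero (f ∘ suc) (f≤0 ∘ suc) Σ≡0 i

  sum-zero : ∀ {k} (f : Fin k → Carrier) → (∀ i → f i ≡ 0#) → sum f ≡ 0#
  sum-zero {k} f f≡0 = trans (sum-cong-≗ f≡0) (sum-replicate-zero k)

module LinearForms (ℝ : Reals) where
  open Reals ℝ
  open Geometry ℝ
  open RealsProperties ℝ using (commutativeRing; sum)
  open CommutativeRing commutativeRing
    using (ring; +-commutativeSemigroup; +-identityˡ; +-identityʳ; distribʳ; zeroˡ; *-identityˡ)
  open import Algebra.Properties.Ring ring using (-0#≈0#; -‿distribˡ-*; -‿+-comm)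
  open import Algebra.Properties.CommutativeSemigroup +-commutativeSemigroup using (interchange)

  basis : ∀ {k} → Fin k → Fin k → Carrier
  basis zero    zero    = 1#
  basis zero    (suc _) = 0#
  basis (suc p) zero    = 0#
  basis (suc p) (suc i) = basis p i

  dot-zeroˡ : ∀ {k} (x : Fin k → Carrier) → dot (λ _ → 0#) x ≡ 0#
  dot-zeroˡ {zero}  x = refl
  dot-zeroˡ {suc k} x = trans (cong₂ _+_ (zeroˡ _) (dot-zeroˡ (λ i → x (suc i)))) (+-identityʳ 0#)

  dot-+ˡ : ∀ {k} (u v x : Fin k → Carrier) → dot (λ i → u i + v i) x ≡ dot u x + dot v x
  dot-+ˡ {zero}  u v x = sym (+-identityʳ 0#)
  dot-+ˡ {suc k} u v x =
    trans (cong₂ _+_ (distribʳ _ _ _) (dot-+ˡ (λ i → u (suc i)) (λ i → v (suc i)) (λ i → x (suc i))))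
          (interchange _ _ _ _)

  dot-negˡ : ∀ {k} (u x : Fin k → Carrier) → dot (λ i → - u i) x ≡ - dot u x
  dot-negˡ {zero}  u x = sym -0#≈0#
  dot-negˡ {suc k} u x =
    trans (cong₂ _+_ (sym (-‿distribˡ-* _ _)) (dot-negˡ (λ i → u (suc i)) (λ i → x (suc i))))
          (-‿+-comm _ _)

  dot-basisˡ : ∀ {k} (p : Fin k) x → dot (basis p) x ≡ x p
  dot-basisˡ zero    x = trans (cong₂ _+_ (*-identityˡ _) (dot-zeroˡ (λ i → x (suc i)))) (+-identityʳ _)
  dot-basisˡ (suc p) x = trans (cong₂ _+_ (zeroˡ _) (dot-basisˡ p (λ i → x (suc i)))) (+-identityˡ _)

  dot-sumˡ : ∀ {j k} (v : Fin j → Fin k → Carrier) x →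
             dot (λ i → sum (λ a → v a i)) x ≡ sum (λ a → dot (v a) x)
  dot-sumˡ {zero}  v x = dot-zeroˡ x
  dot-sumˡ {suc j} v x =
    trans (dot-+ˡ (v zero) (λ i → sum (λ a → v (suc a) i)) x)
          (cong (dot (v zero) x +_) (dot-sumˡ (λ a → v (suc a)) x))

  dot-basis-difference : ∀ {k} (p q : Fin k) x → dot (λ i → basis p i + - basis q i) x ≡ x p + - x q
  dot-basis-difference p q x = begin
    dot (λ i → basis p i + - basis q i) x         ≡⟨ dot-+ˡ (basis p) (λ i → - basis q i) x ⟩
    dot (basis p) x + dot (λ i → - basis q i) x   ≡⟨ cong₂ _+_ (dot-basisˡ p x) (dot-negˡ (basis q) x) ⟩
    x p + - dot (basis q) x                       ≡⟨ cong (λ v → x p + - v) (dot-basisˡ q x) ⟩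
    x p + - x q                                   ∎
    where open ≡-Reasoning

  IsFace⇒⊆ : ∀ {k} {F Q : (Fin k → Carrier) → Set} → IsFace F Q → ∀ x → F x → Q x
  IsFace⇒⊆ (_ , _ , _ , F⇔) x Fx = proj₁ (Equivalence.to (F⇔ x) Fx)

module AdmissibleChain (ℝ : Reals) {n : ℕ} (_≼_ : Rel (Fin n) 0ℓ) (Pstar : Subset n) (lam : Fin n → Reals.Carrier ℝ)
                       {m : ℕ} {L : Vec (Subset n) m} (adm : Setup.IsAdmissible ℝ _≼_ Pstar lam L) where
  open Reals ℝ
  open Setup ℝ _≼_ Pstar lam
  open RealsProperties ℝ
  open import Data.List.Extrema totalOrder
    using (min; max; min≤⊤; ⊥≤max; min≤xs; xs≤max; min≈v⁺; max≈v⁺; max<v⁺; v<min⁺; max-mono-⊆; min-mono-⊆)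
  open import Relation.Binary.Reasoning.PartialOrder poset

  ascending : Ascending L
  ascending j = proj₁ (proj₂ (proj₁ adm) (suc j))

  ∈ideal⇒block< : ∀ {p k} → p ∈ ideal L k → block L p Fin.< k
  ∈ideal⇒block< {k = zero}  p∈ = contradiction p∈ ∉⊥
  ∈ideal⇒block< {k = suc i} p∈ = s≤s (block-minimal L p∈)

  block<⇒∈ideal : ∀ {p k} → block L p Fin.< k → p ∈ ideal L k
  block<⇒∈ideal {k = suc i} (s≤s b≤i) = block≤⇒∈ideal⁺ L ascending b≤i

  InBlock⇒block≡ : ∀ {i p} → InBlock L i p → block L p ≡ i
  InBlock⇒block≡ {i} {p} (p∈ , p∉) = Fin.≤-antisym (ℕ.s≤s⁻¹ (∈ideal⇒block< p∈)) i≤b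
    where
    i≤b : i Fin.≤ block L p
    i≤b = subst (ℕ._≤ toℕ (block L p)) (Fin.toℕ-inject₁ i) (ℕ.≮⇒≥ (λ b<i → p∉ (block<⇒∈ideal b<i)))

  block≡⇒InBlock : ∀ {i p} → block L p ≡ i → InBlock L i p
  block≡⇒InBlock refl =
    block<⇒∈ideal (ℕ.n<1+n _) , λ p∈ → ℕ.<-irrefl (sym (Fin.toℕ-inject₁ _)) (∈ideal⇒block< p∈)

  block-surjective : ∀ i → ∃ λ p → block L p ≡ i
  block-surjective i with proj₂ (proj₂ (proj₁ adm) i)
  ... | p , p∈ , p∉ = p , InBlock⇒block≡ (p∈ , p∉)

  ideal⁺-inject₁-proper : ∀ j → ∃ λ u → u ∉ ideal⁺ L (inject₁ j)
  ideal⁺-inject₁-proper j with block-surjective (suc j)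
  ... | u , bu≡j+1 = u , λ u∈ → ℕ.<⇒≱ j<bu (block-minimal L u∈)
    where
    j<bu : toℕ (inject₁ j) ℕ.< toℕ (block L u)
    j<bu = ℕ.≤-reflexive (trans (cong suc (Fin.toℕ-inject₁ j)) (cong toℕ (sym bu≡j+1)))

  ideal⁺-nonempty : ∀ i → ∃ λ w → w ∈ ideal⁺ L i
  ideal⁺-nonempty i with block-surjective i
  ... | w , refl = w , ∈-ideal⁺-block L w

  lam-constant : ∀ {s s'} → s ∈ Pstar → s' ∈ Pstar → block L s ≡ block L s' → lam s ≡ lam s'
  lam-constant s∈ s'∈ b≡b' = proj₁ (proj₂ adm) _ _ _ (block≡⇒InBlock refl) s∈ (block≡⇒InBlock (sym b≡b')) s'∈

  lam-strictMono : ∀ {s s'} → s ∈ Pstar → s' ∈ Pstar → block L s Fin.< block L s' → lam s < lam s'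
  lam-strictMono s∈ s'∈ b<b' = proj₂ (proj₂ adm) _ _ b<b' _ _ (block≡⇒InBlock refl) s∈ (block≡⇒InBlock refl) s'∈

  lam-mono : ∀ {s s'} → s ∈ Pstar → s' ∈ Pstar → block L s Fin.≤ block L s' → lam s ≤ lam s'
  lam-mono s∈ s'∈ b≤b' with ℕ.m≤n⇒m<n∨m≡n b≤b'
  ... | inj₁ b<b' = <⇒≤ (lam-strictMono s∈ s'∈ b<b')
  ... | inj₂ b≡b' = ≤-reflexive (lam-constant s∈ s'∈ (Fin.toℕ-injective b≡b'))

  BlockMonotone : (Fin n → Carrier) → Set
  BlockMonotone x = ∀ {p q} → block L p Fin.≤ block L q → x p ≤ x q

  F⇒BlockMonotone : ∀ {x} → F L x → BlockMonotone x
  F⇒BlockMonotone {x} (_ , constant , stepwise) {p} {q} bp≤bq =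
    subst₂ _≤_ (sym (onBlock p)) (sym (onBlock q)) (stepwise⇒monotone preorder t step bp≤bq)
    where
    rep : Fin (suc m) → Fin n
    rep i = proj₁ (block-surjective i)
    rep-InBlock : ∀ i → InBlock L i (rep i)
    rep-InBlock i = block≡⇒InBlock (proj₂ (block-surjective i))
    t : Fin (suc m) → Carrier
    t i = x (rep i)
    onBlock : ∀ p → x p ≡ t (block L p)
    onBlock p = constant _ p _ (block≡⇒InBlock refl) (rep-InBlock (block L p))
    step : ∀ j → t (inject₁ j) ≤ t (suc j)
    step j = stepwise j _ _ (rep-InBlock (inject₁ j)) (rep-InBlock (suc j))

  BlockMonotone⇒F : ∀ {x} → (∀ p → p ∈ Pstar → x p ≡ lam p) → BlockMonotone x → F L x
  BlockMonotone⇒F x≡lam mono =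
      x≡lam
    , (λ i p q p∈i q∈i → antisym (mono (ℕ.≤-reflexive (cong toℕ (same p∈i q∈i))))
                                 (mono (ℕ.≤-reflexive (cong toℕ (same q∈i p∈i)))))
    , (λ i p q p∈i q∈i+1 → mono (subst₂ Fin._≤_ (sym (InBlock⇒block≡ p∈i)) (sym (InBlock⇒block≡ q∈i+1))
                                         (ℕ.≤-trans (ℕ.≤-reflexive (Fin.toℕ-inject₁ i)) (ℕ.n≤1+n _))))
    where
    same : ∀ {i p q} → InBlock L i p → InBlock L i q → block L p ≡ block L q
    same p∈i q∈i = trans (InBlock⇒block≡ p∈i) (sym (InBlock⇒block≡ q∈i))

  labels : {S : Pred (Fin n) 0ℓ} → Relation.Unary.Decidable S → List Carrier
  labels S? = map lam (filter (λ s → s ∈? Pstar ×-dec S? s) (allFin n))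

  module _ {S : Pred (Fin n) 0ℓ} (S? : Relation.Unary.Decidable S) where

    ∈-labels⁺ : ∀ {s} → s ∈ Pstar → S s → lam s ∈ˡ labels S?
    ∈-labels⁺ s∈ Ss = ∈-map⁺ lam (∈-filter⁺ (λ s → s ∈? Pstar ×-dec S? s) (∈-allFin _) (s∈ , Ss))

    ∈-labels⁻ : ∀ {v} → v ∈ˡ labels S? → ∃ λ s → s ∈ Pstar × S s × v ≡ lam s
    ∈-labels⁻ v∈ with ∈-map⁻ lam v∈
    ... | s , s∈ , refl with proj₂ (∈-filter⁻ (λ s → s ∈? Pstar ×-dec S? s) {xs = allFin n} s∈)
    ...   | s∈P , Ss = s , s∈P , Ss , refl

    labels-all : ∀ {P : Pred Carrier 0ℓ} → (∀ {s} → s ∈ Pstar → S s → P (lam s)) → All.All P (labels S?)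
    labels-all P-lam = All.tabulate λ v∈ → case ∈-labels⁻ v∈ of λ { (s , s∈ , Ss , refl) → P-lam s∈ Ss }

  allLabels : List Carrier
  allLabels = labels U?

  belowAll aboveAll : Carrier
  belowAll = min 0# allLabels + - 1#
  aboveAll = max 0# allLabels + 1#

  belowAll<lam : ∀ {s} → s ∈ Pstar → belowAll < lam s
  belowAll<lam s∈ = begin-strict
    belowAll          <⟨ x-1<x _ ⟩
    min 0# allLabels  ≤⟨ All.lookup (min≤xs 0# allLabels) (∈-labels⁺ U? s∈ _) ⟩
    lam _             ∎

  lam<aboveAll : ∀ {s} → s ∈ Pstar → lam s < aboveAll
  lam<aboveAll s∈ = begin-strict
    lam _             ≤⟨ All.lookup (xs≤max 0# allLabels) (∈-labels⁺ U? s∈ _) ⟩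
    max 0# allLabels  <⟨ x<x+1 _ ⟩
    aboveAll          ∎

  belowAll<aboveAll : belowAll < aboveAll
  belowAll<aboveAll = begin-strict
    belowAll          <⟨ x-1<x _ ⟩
    min 0# allLabels  ≤⟨ min≤⊤ 0# allLabels ⟩
    0#                ≤⟨ ⊥≤max 0# allLabels ⟩
    max 0# allLabels  <⟨ x<x+1 _ ⟩
    aboveAll          ∎

  atOrBelow? : (p : Fin n) → Relation.Unary.Decidable (λ s → block L s Fin.≤ block L p)
  atOrBelow? p s = block L s Fin.≤? block L p

  atOrAbove? : (p : Fin n) → Relation.Unary.Decidable (λ s → block L p Fin.≤ block L s)
  atOrAbove? p s = block L p Fin.≤? block L s

  maxBelow minAbove : Fin n → Carrier
  maxBelow p = max belowAll (labels (atOrBelow? p))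
  minAbove p = min aboveAll (labels (atOrAbove? p))

  maxBelow-onPstar : ∀ {p} → p ∈ Pstar → maxBelow p ≡ lam p
  maxBelow-onPstar p∈ =
    max≈v⁺ (∈-labels⁺ _ p∈ ℕ.≤-refl) (labels-all _ (λ s∈ → lam-mono s∈ p∈)) (<⇒≤ (belowAll<lam p∈))

  minAbove-onPstar : ∀ {p} → p ∈ Pstar → minAbove p ≡ lam p
  minAbove-onPstar p∈ =
    min≈v⁺ (∈-labels⁺ _ p∈ ℕ.≤-refl) (labels-all _ (λ s∈ → lam-mono p∈ s∈)) (<⇒≤ (lam<aboveAll p∈))

  maxBelow-mono : BlockMonotone maxBelow
  maxBelow-mono {p} {q} bp≤bq = max-mono-⊆ ≤-refl λ v∈ → case ∈-labels⁻ (atOrBelow? p) v∈ of λ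
    { (s , s∈ , bs≤bp , refl) → ∈-labels⁺ (atOrBelow? q) s∈ (ℕ.≤-trans bs≤bp bp≤bq) }

  minAbove-mono : BlockMonotone minAbove
  minAbove-mono {p} {q} bp≤bq = min-mono-⊆ ≤-refl λ v∈ → case ∈-labels⁻ (atOrAbove? q) v∈ of λ
    { (s , s∈ , bq≤bs , refl) → ∈-labels⁺ (atOrAbove? p) s∈ (ℕ.≤-trans bp≤bq bq≤bs) }

  maxBelow<minAbove : ∀ {p q} → block L p Fin.< block L q → maxBelow p < minAbove q
  maxBelow<minAbove {p} {q} bp<bq =
    max<v⁺ (v<min⁺ belowAll<aboveAll (labels-all _ (λ s'∈ _ → belowAll<lam s'∈))) (labels-all _ lam<minAbove)
    where
    lam<minAbove : ∀ {s} → s ∈ Pstar → block L s Fin.≤ block L p → lam s < minAbove q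
    lam<minAbove s∈ bs≤bp = v<min⁺ (lam<aboveAll s∈)
      (labels-all _ (λ s'∈ bq≤bs' → lam-strictMono s∈ s'∈ (ℕ.≤-<-trans bs≤bp (ℕ.<-≤-trans bp<bq bq≤bs'))))

  cutPoint : Fin (suc m) → Fin n → Carrier
  cutPoint i p with block L p Fin.≤? i
  ... | yes _ = maxBelow p
  ... | no  _ = minAbove p

  cutPoint-∈F : ∀ i → F L (cutPoint i)
  cutPoint-∈F i = BlockMonotone⇒F onPstar mono
    where
    onPstar : ∀ p → p ∈ Pstar → cutPoint i p ≡ lam p
    onPstar p p∈ with block L p Fin.≤? i
    ... | yes _ = maxBelow-onPstar p∈
    ... | no  _ = minAbove-onPstar p∈
    mono : BlockMonotone (cutPoint i)
    mono {p} {q} bp≤bq with block L p Fin.≤? i | block L q Fin.≤? i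
    ... | yes _     | yes _     = maxBelow-mono bp≤bq
    ... | yes bp≤i  | no  bq≰i  = <⇒≤ (maxBelow<minAbove (ℕ.≤-<-trans bp≤i (ℕ.≰⇒> bq≰i)))
    ... | no  bp≰i  | yes bq≤i  = contradiction (ℕ.≤-trans bp≤bq bq≤i) bp≰i
    ... | no  _     | no  _     = minAbove-mono bp≤bq

  cutPoint-separates : ∀ {i p q} → block L p Fin.≤ i → i Fin.< block L q → cutPoint i p < cutPoint i q
  cutPoint-separates {i} {p} {q} bp≤i i<bq with block L p Fin.≤? i | block L q Fin.≤? i
  ... | yes _    | no  _    = maxBelow<minAbove (ℕ.≤-<-trans bp≤i i<bq)
  ... | no  bp≰i | _        = contradiction bp≤i bp≰i
  ... | yes _    | yes bq≤i = contradiction i<bq (ℕ.≤⇒≯ bq≤i)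

module TwoChains (ℝ : Reals) {n : ℕ} (_≼_ : Rel (Fin n) 0ℓ) (Pstar : Subset n) (lam : Fin n → Reals.Carrier ℝ)
                 {m m' : ℕ} {L : Vec (Subset n) m} {L' : Vec (Subset n) m'}
                 (adm : Setup.IsAdmissible ℝ _≼_ Pstar lam L) (adm' : Setup.IsAdmissible ℝ _≼_ Pstar lam L') where
  open Reals ℝ
  open Setup ℝ _≼_ Pstar lam
  open RealsProperties ℝ
  open LinearForms ℝ
  module C  = AdmissibleChain ℝ _≼_ Pstar lam adm
  module C' = AdmissibleChain ℝ _≼_ Pstar lam adm'

  subChain⇒coarser : SubChain L L' → CoarserThan L L'
  subChain⇒coarser sub {p} {q} b'p≤b'q with block L q | ∈-ideal⁺-block L q
  ... | i | q∈ with view i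
  ...   | ‵fromℕ     = Fin.≤fromℕ (block L p)
  ...   | ‵inject₁ j with ∈⇒ideal⁺-inject₁ (sub _ (ideal⁺-inject₁-∈ L j))
  ...     | j' , I≡I' = block-minimal L (subst (p ∈_) (sym I≡I') p∈I')
    where
    p∈I' : p ∈ ideal⁺ L' (inject₁ j')
    p∈I' = block≤⇒∈ideal⁺ L' C'.ascending
             (ℕ.≤-trans b'p≤b'q (block-minimal L' (subst (q ∈_) I≡I' q∈)))

  coarser⇒downClosed : CoarserThan L L' →
                       ∀ {i q r} → q ∈ ideal⁺ L i → block L' r Fin.≤ block L' q → r ∈ ideal⁺ L i
  coarser⇒downClosed coarser q∈ b'r≤b'q =
    block≤⇒∈ideal⁺ L C.ascending (ℕ.≤-trans (coarser b'r≤b'q) (block-minimal L q∈))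

  coarser⇒subChain : CoarserThan L L' → SubChain L L'
  coarser⇒subChain coarser I I∈L with ∈⇒ideal⁺-inject₁ I∈L
  ... | j , refl with ideal⁺-of-downClosed L' C'.ascending (ideal⁺ L (inject₁ j))
                        (proj₂ (C.ideal⁺-nonempty _)) (coarser⇒downClosed coarser)
  ... | i' , I≡I' with view i'
  ...   | ‵inject₁ j' = subst (_∈ᵛ L') (sym I≡I') (ideal⁺-inject₁-∈ L' j')
  ...   | ‵fromℕ      with C.ideal⁺-inject₁-proper j
  ...     | u , u∉ = contradiction (subst (u ∈_) (sym I≡I') (block≤⇒∈ideal⁺ L' C'.ascending (Fin.≤fromℕ _))) u∉

  F⊆F'⇒coarser : (∀ x → F L x → F L' x) → CoarserThan L L'
  F⊆F'⇒coarser F⊆F' {p} {q} b'p≤b'q with block L p Fin.≤? block L q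
  ... | yes bp≤bq = bp≤bq
  ... | no  bp≰bq = contradiction (C'.F⇒BlockMonotone (F⊆F' _ (C.cutPoint-∈F (block L q))) b'p≤b'q)
                                  (<⇒≱ (C.cutPoint-separates ℕ.≤-refl (ℕ.≰⇒> bp≰bq)))

  Merged : Fin n → Fin n → Set
  Merged p q = block L p ≡ block L q × block L' p Fin.< block L' q

  merged? : ∀ p q → Dec (Merged p q)
  merged? p q = (block L p Fin.≟ block L q) ×-dec (block L' p Fin.<? block L' q)

  edge : Fin n → Fin n → Fin n → Carrier
  edge p q with merged? p q
  ... | yes _ = λ i → basis p i + - basis q i
  ... | no  _ = λ _ → 0#

  edge-nonpos : ∀ {x} → C'.BlockMonotone x → ∀ p q → dot (edge p q) x ≤ 0#
  edge-nonpos {x} mono' p q with merged? p q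
  ... | yes (_ , b'p<b'q) =
    subst (_≤ 0#) (sym (dot-basis-difference p q x)) (x≤y⇒x-y≤0 (mono' (ℕ.<⇒≤ b'p<b'q)))
  ... | no  _             = ≤-reflexive (dot-zeroˡ x)

  edge-null : ∀ {x} → C.BlockMonotone x → ∀ p q → dot (edge p q) x ≡ 0#
  edge-null {x} mono p q with merged? p q
  ... | yes (bp≡bq , _) = trans (dot-basis-difference p q x)
                                (x≡y⇒x-y≡0 (antisym (mono (ℕ.≤-reflexive (cong toℕ bp≡bq)))
                                                    (mono (ℕ.≤-reflexive (cong toℕ (sym bp≡bq))))))
  ... | no  _           = dot-zeroˡ x

  edge-null⇒≡ : ∀ {x p q} → Merged p q → dot (edge p q) x ≡ 0# → x p ≡ x q
  edge-null⇒≡ {x} {p} {q} pq-merged null with merged? p q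
  ... | yes _         = x-y≡0⇒x≡y (trans (sym (dot-basis-difference p q x)) null)
  ... | no  ¬pq-merged = contradiction pq-merged ¬pq-merged

  functional : Fin n → Carrier
  functional i = sum (λ p → sum (λ q → edge p q i))

  dot-functional : ∀ x → dot functional x ≡ sum (λ p → sum (λ q → dot (edge p q) x))
  dot-functional x = trans (dot-sumˡ (λ p i → sum (λ q → edge p q i)) x)
                           (sum-cong-≗ (λ p → dot-sumˡ (edge p) x))

  coarser⇒face : CoarserThan L L' → IsFace (F L) (F L')
  coarser⇒face coarser = functional , 0# , valid , λ x → mk⇔ (to x) (from x)
    where
    valid : ∀ x → F L' x → dot functional x ≤ 0#
    valid x x∈F' = subst (_≤ 0#) (sym (dot-functional x))
      (sum-nonpos _ (λ p → sum-nonpos _ (edge-nonpos (C'.F⇒BlockMonotone x∈F') p)))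
    to : ∀ x → F L x → F L' x × dot functional x ≡ 0#
    to x x∈F = C'.BlockMonotone⇒F (proj₁ x∈F) (mono ∘ coarser)
             , trans (dot-functional x) (sum-zero _ (λ p → sum-zero _ (edge-null mono p)))
      where
      mono : C.BlockMonotone x
      mono = C.F⇒BlockMonotone x∈F
    from : ∀ x → F L' x × dot functional x ≡ 0# → F L x
    from x (x∈F' , null) = C.BlockMonotone⇒F (proj₁ x∈F') mono
      where
      mono' : C'.BlockMonotone x
      mono' = C'.F⇒BlockMonotone x∈F'
      edges-null : ∀ p q → dot (edge p q) x ≡ 0#
      edges-null p = sum-nonpos-zero _ (edge-nonpos mono' p)
        (sum-nonpos-zero _ (λ p → sum-nonpos _ (edge-nonpos mono' p)) (trans (sym (dot-functional x)) null) p)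
      mono : C.BlockMonotone x
      mono {p} {q} bp≤bq with block L' p Fin.≤? block L' q
      ... | yes b'p≤b'q = mono' b'p≤b'q
      ... | no  b'p≰b'q = ≤-reflexive (sym (edge-null⇒≡ (bq≡bp , b'q<b'p) (edges-null q p)))
        where
        b'q<b'p : block L' q Fin.< block L' p
        b'q<b'p = ℕ.≰⇒> b'p≰b'q
        bq≡bp : block L q ≡ block L p
        bq≡bp = Fin.≤-antisym (coarser (ℕ.<⇒≤ b'q<b'p)) bp≤bq

corollary2p16 : (ℝ : Reals) (n : ℕ) (_≼_ : Rel (Fin n) 0ℓ) →
    IsPartialOrder _≡_ _≼_ →
    (Pstar : Subset n) (lam : Fin n → Reals.Carrier ℝ) →
    let open Setup ℝ _≼_ Pstar lam in
    ContainsExtremes → OrderPreserving →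
    ∀ {m m'} (L : Vec (Subset n) m) (L' : Vec (Subset n) m') →
    IsAdmissible L → IsAdmissible L' →
    (IsFace (F L) (F L') ⇔ SubChain L L')
corollary2p16 ℝ n _≼_ _ Pstar lam _ _ L L' adm adm' =
  mk⇔ (coarser⇒subChain ∘ F⊆F'⇒coarser ∘ IsFace⇒⊆) (coarser⇒face ∘ subChain⇒coarser)
  where
  open LinearForms ℝ using (IsFace⇒⊆)
  open TwoChains ℝ _≼_ Pstar lam adm adm'
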